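{- For every integer $n>1$, $$p_n=p_{n-1}+(1-\psi)\big(\lfloor (n+1)\phi\rfloor-\lfloor n\phi\rfloor-1\big)+\psi .$$
   Context: Let $\phi=\frac{1+\sqrt5}{2}$ and $\psi=1/\phi$. The Fibonacci words over $\{A,B\}$ are $w_1=A$, $w_2=AB$, $w_{n+2}=w_{n+1}w_n$; the infinite Fibonacci word $c_1c_2c_3\cdots=ABAABABAAB\cdots$ is their common extension. With $v(A)=1$, $v(B)=\psi$, set $p_0=0$ and $p_m=\sum_{i=1}^m v(c_i)$ for $m\ge1$ (so $p_m$ is the $m$-th successor of $0$ in the ordered list $0,1,\phi,\phi+1,\phi+2,2\phi+1,\dots$ of phinary numbers). $\lfloor x\rfloor$ is the floor function. -}

module Defs where

open import Data.Nat using (ℕ; zero; suc; _+_; _*_; _∸_; _^_; _≤_; _<_)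
open import Data.Integer as ℤ using (ℤ; +_)
open import Data.List using (List; []; _∷_; _++_)
open import Data.Product using (_×_; _,_)
open import Data.Sum using (_⊎_)

-- Elements a + b·φ of ℤ[φ], represented by the pair (a , b).
-- Since 1 and φ are linearly independent over ℚ, equality of pairs
-- is exactly equality of the real numbers they denote.
ℤφ : Set
ℤφ = ℤ × ℤ

infixl 6 _+φ_
infixl 7 _*φ_

_+φ_ : ℤφ → ℤφ → ℤφ
(a , b) +φ (c , d) = (a ℤ.+ c , b ℤ.+ d)

-- (a + bφ)(c + dφ) = (ac + bd) + (ad + bc + bd)φ   using φ² = φ + 1
_*φ_ : ℤφ → ℤφ → ℤφ
(a , b) *φ (c , d) = (a ℤ.* c ℤ.+ b ℤ.* d , a ℤ.* d ℤ.+ b ℤ.* c ℤ.+ b ℤ.* d)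

ι : ℤ → ℤφ
ι a = (a , + 0)

oneφ : ℤφ
oneφ = (+ 1 , + 0)

-- ψ = 1/φ = φ - 1
ψ : ℤφ
ψ = (ℤ.- (+ 1) , + 1)

oneMinusψ : ℤφ
oneMinusψ = (+ 2 , ℤ.- (+ 1))

data Letter : Set where
  A B : Letter

-- fibWord n = w_(n+1):  w_1 = A, w_2 = AB, w_(n+2) = w_(n+1) w_n
fibWord : ℕ → List Letter
fibWord zero = A ∷ []
fibWord (suc zero) = A ∷ B ∷ []
fibWord (suc (suc n)) = fibWord (suc n) ++ fibWord n

-- i-th letter (0-based) of a list, default A when out of range
-- (never used out of range below).
nth : List Letter → ℕ → Letter
nth [] _ = A
nth (x ∷ _) zero = x
nth (_ ∷ xs) (suc i) = nth xs i

-- c i = c_i (1-based) of the infinite Fibonacci word; w_i has length ≥ i,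
-- so its i-th letter is the i-th letter of the infinite word.
c : ℕ → Letter
c i = nth (fibWord i) (i ∸ 1)

v : Letter → ℤφ
v A = oneφ
v B = ψ

p : ℕ → ℤφ
p zero = (+ 0 , + 0)
p (suc m) = p m +φ v (c (suc m))

-- IsFloorNφ n k  :⇔  k = ⌊ n φ ⌋ , i.e.  k ≤ nφ < k + 1,
-- written with exact integer arithmetic (nφ = (n + n√5)/2):
--   k ≤ nφ      ⇔  2k ≤ n  ∨  (2k - n)² ≤ 5n²
--   nφ < k + 1  ⇔  n < 2(k+1)  ∧  5n² < (2(k+1) - n)²
IsFloorNφ : ℕ → ℕ → Set
IsFloorNφ n k =
  (2 * k ≤ n ⊎ (2 * k ∸ n) ^ 2 ≤ 5 * n ^ 2)
  × (n < 2 * suc k × 5 * n ^ 2 < (2 * suc k ∸ n) ^ 2)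

module Submission where

-- Since p_n − p_{n−1} = v(c_n) with v(A) = 1 = (1 − ψ) + ψ and v(B) = ψ, the theorem says
-- that ⌊(n + 1)φ⌋ − ⌊nφ⌋ is 2 when c_n = A and 1 when c_n = B.  Both follow from the
-- floor formula
--          ⌊(m + 1)φ⌋ = (m + 1) + #A(c₁ … c_m),
-- proved by strong induction on m.

open import Defs
open import Data.Nat using (ℕ; suc; _<_; _∸_)
open import Data.Integer using (+_; _-_)
open import Relation.Binary.PropositionalEquality using (_≡_; sym; subst₂)

module FibonacciWord where

  open import Data.Nat
  open import Data.Nat.Properties
  open import Data.List using (List; []; _∷_; _++_; length; take)
  open import Data.List.Properties using (length-++; ++-assoc; ++-identityʳ)
  open import Data.Product using (∃-syntax; _×_; _,_)
  open import Data.Sum using (_⊎_; inj₁; inj₂)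
  open import Relation.Binary.PropositionalEquality

  σ : List Letter → List Letter
  σ [] = []
  σ (A ∷ u) = A ∷ B ∷ σ u
  σ (B ∷ u) = A ∷ σ u

  σ-++ : ∀ u w → σ (u ++ w) ≡ σ u ++ σ w
  σ-++ [] w = refl
  σ-++ (A ∷ u) w = cong (λ z → A ∷ B ∷ z) (σ-++ u w)
  σ-++ (B ∷ u) w = cong (A ∷_) (σ-++ u w)

  -- σ maps each Fibonacci word to the next one, so the infinite word is a fixed point of σ.
  σ-fibWord : ∀ K → σ (fibWord K) ≡ fibWord (suc K)
  σ-fibWord zero = refl
  σ-fibWord (suc zero) = refl
  σ-fibWord (suc (suc K)) = begin
    σ (fibWord (suc K) ++ fibWord K)        ≡⟨ σ-++ (fibWord (suc K)) (fibWord K) ⟩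
    σ (fibWord (suc K)) ++ σ (fibWord K)    ≡⟨ cong₂ _++_ (σ-fibWord (suc K)) (σ-fibWord K) ⟩
    fibWord (suc (suc K)) ++ fibWord (suc K) ∎
    where open ≡-Reasoning

  fibWord-length : ∀ K → suc K ≤ length (fibWord K)
  fibWord-length zero = s≤s z≤n
  fibWord-length (suc zero) = s≤s (s≤s z≤n)
  fibWord-length (suc (suc K)) = begin
    suc (suc (suc K))                                 ≡⟨ +-comm (suc (suc K)) 1 ⟨
    suc (suc K) + 1                                   ≤⟨ +-mono-≤ (fibWord-length (suc K))
                                                           (≤-trans (s≤s z≤n) (fibWord-length K)) ⟩
    length (fibWord (suc K)) + length (fibWord K)     ≡⟨ length-++ (fibWord (suc K)) ⟨
    length (fibWord (suc K) ++ fibWord K)             ∎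
    where open ≤-Reasoning

  fibWord-prefix : ∀ d K → ∃[ t ] fibWord (d + K) ≡ fibWord K ++ t
  fibWord-prefix zero K = [] , sym (++-identityʳ (fibWord K))
  fibWord-prefix (suc d) K with fibWord-prefix d K | fibWord-step (d + K)
    where
    fibWord-step : ∀ K → ∃[ t ] fibWord (suc K) ≡ fibWord K ++ t
    fibWord-step zero = B ∷ [] , refl
    fibWord-step (suc K) = fibWord K , refl
  ... | t , e | t′ , e′ =
    t ++ t′ , trans e′ (trans (cong (_++ t′) e) (++-assoc (fibWord K) t t′))

  nth-++ : ∀ u t i → i < length u → nth (u ++ t) i ≡ nth u i
  nth-++ (x ∷ u) t zero _ = refl
  nth-++ (x ∷ u) t (suc i) (s≤s i<u) = nth-++ u t i i<u

  nth-fibWord-mono : ∀ {K K′} i → K ≤ K′ → i < length (fibWord K) →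
                     nth (fibWord K′) i ≡ nth (fibWord K) i
  nth-fibWord-mono {K} {K′} i K≤K′ i<K with m≤n⇒∃[o]m+o≡n K≤K′
  ... | d , e with fibWord-prefix d K
  ...   | t , e′ = begin
    nth (fibWord K′) i         ≡⟨ cong (λ k → nth (fibWord k) i) (trans (sym e) (+-comm K d)) ⟩
    nth (fibWord (d + K)) i    ≡⟨ cong (λ w → nth w i) e′ ⟩
    nth (fibWord K ++ t) i     ≡⟨ nth-++ (fibWord K) t i i<K ⟩
    nth (fibWord K) i          ∎
    where open ≡-Reasoning

  nth-fibWord : ∀ K i → i < length (fibWord K) → nth (fibWord K) i ≡ c (suc i)
  nth-fibWord K i i<K with ≤-total K (suc i)
  ... | inj₁ K≤i = sym (nth-fibWord-mono i K≤i i<K)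
  ... | inj₂ i≤K = nth-fibWord-mono i i≤K (≤-trans (n≤1+n (suc i)) (fibWord-length (suc i)))

  isA : Letter → ℕ
  isA A = 1
  isA B = 0

  numA : List Letter → ℕ
  numA [] = 0
  numA (x ∷ u) = isA x + numA u

  countA : ℕ → ℕ
  countA zero = 0
  countA (suc m) = countA m + isA (c (suc m))

  numA-take-suc : ∀ u j → j < length u → numA (take (suc j) u) ≡ numA (take j u) + isA (nth u j)
  numA-take-suc (x ∷ u) zero _ = +-comm (isA x) 0
  numA-take-suc (x ∷ u) (suc j) (s≤s j<u) =
    trans (cong (λ z → isA x + z) (numA-take-suc u j j<u)) (sym (+-assoc (isA x) _ _))

  numA-fibWord : ∀ K j → j ≤ length (fibWord K) → numA (take j (fibWord K)) ≡ countA j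
  numA-fibWord K zero _ = refl
  numA-fibWord K (suc j) j<K = begin
    numA (take (suc j) (fibWord K))              ≡⟨ numA-take-suc (fibWord K) j j<K ⟩
    numA (take j (fibWord K)) + isA (nth (fibWord K) j)
      ≡⟨ cong₂ _+_ (numA-fibWord K j (≤-trans (n≤1+n j) j<K)) (cong isA (nth-fibWord K j j<K)) ⟩
    countA j + isA (c (suc j))                   ∎
    where open ≡-Reasoning

  -- Position m of σ u lies in the image σ(uᵢ) of some letter uᵢ (i < |u|).  The preceding
  -- block σ(u₀ … uᵢ₋₁) has length i + #A(u₀ … uᵢ₋₁) and contains exactly i letters A,
  -- one at the start of each image; position m is either the first letter (always A) of
  -- σ(uᵢ) or its second letter.
  σ-position : ∀ u m → m < length (σ u) → ∃[ i ] i < length u ×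
    (m ≡ i + numA (take i u) × numA (take m (σ u)) ≡ i
     ⊎ m ≡ suc (i + numA (take i u)) × numA (take m (σ u)) ≡ suc i)
  σ-position (A ∷ u) zero _ = 0 , s≤s z≤n , inj₁ (refl , refl)
  σ-position (A ∷ u) (suc zero) _ = 0 , s≤s z≤n , inj₂ (refl , refl)
  σ-position (A ∷ u) (suc (suc m)) (s≤s (s≤s m<u)) with σ-position u m m<u
  ... | i , i<u , inj₁ (e , e′) =
    suc i , s≤s i<u , inj₁ (cong suc (trans (cong suc e) (sym (+-suc i _))) , cong suc e′)
  ... | i , i<u , inj₂ (e , e′) =
    suc i , s≤s i<u , inj₂ (cong suc (trans (cong suc e) (cong suc (sym (+-suc i _)))) , cong suc e′)
  σ-position (B ∷ u) zero _ = 0 , s≤s z≤n , inj₁ (refl , refl)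
  σ-position (B ∷ u) (suc m) (s≤s m<u) with σ-position u m m<u
  ... | i , i<u , inj₁ (e , e′) = suc i , s≤s i<u , inj₁ (cong suc e , cong suc e′)
  ... | i , i<u , inj₂ (e , e′) = suc i , s≤s i<u , inj₂ (cong suc e , cong suc e′)

  -- Desubstitution of c = σ(c): the first m letters of c are σ(c₁ … cᵢ) for some i, possibly
  -- followed by the first letter A of σ(cᵢ₊₁).
  desubstitute : ∀ m → ∃[ i ]
    (m ≡ i + countA i × countA m ≡ i ⊎ m ≡ suc (i + countA i) × countA m ≡ suc i)
  desubstitute m with σ-position (fibWord m) m (subst (λ w → m < length w) (sym (σ-fibWord m))
                                                  (≤-trans (n≤1+n (suc m)) (fibWord-length (suc m))))
  ... | i , i<m , position = i , transfer position
    where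
    countA-i : numA (take i (fibWord m)) ≡ countA i
    countA-i = numA-fibWord m i (<⇒≤ i<m)
    countA-m : numA (take m (σ (fibWord m))) ≡ countA m
    countA-m = trans (cong (λ w → numA (take m w)) (σ-fibWord m))
                     (numA-fibWord (suc m) m (≤-trans (n≤1+n m) (<⇒≤ (fibWord-length (suc m)))))
    transfer : m ≡ i + numA (take i (fibWord m)) × numA (take m (σ (fibWord m))) ≡ i
             ⊎ m ≡ suc (i + numA (take i (fibWord m))) × numA (take m (σ (fibWord m))) ≡ suc i
             → m ≡ i + countA i × countA m ≡ i ⊎ m ≡ suc (i + countA i) × countA m ≡ suc i
    transfer (inj₁ (e , e′)) =
      inj₁ (trans e (cong (λ a → i + a) countA-i) , trans (sym countA-m) e′)
    transfer (inj₂ (e , e′)) =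
      inj₂ (trans e (cong (λ a → suc (i + a)) countA-i) , trans (sym countA-m) e′)

module Irrationality where

  open import Data.Nat
  open import Data.Nat.Properties
  open import Data.Nat.Induction using (<-rec)
  open import Data.Nat.Tactic.RingSolver using (solve-∀)
  open import Data.Product using (_,_)
  open import Relation.Nullary using (¬_; yes; no)
  open import Relation.Binary.PropositionalEquality

  -- By infinite descent:
  -- m ≤ k is impossible since then m² ≤ mk < mk + k², and for m = k + r the pair (k, r)
  -- is again a solution, with 1 ≤ r < k.
  no-golden-ratio : ∀ k m → 1 ≤ k → ¬ (m * m ≡ m * k + k * k)
  no-golden-ratio = <-rec (λ k → ∀ m → 1 ≤ k → ¬ (m * m ≡ m * k + k * k)) descent
    where
    too-small : ∀ {m k} → m ≤ k → 1 ≤ k → ¬ (m * m ≡ m * k + k * k)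
    too-small {m} {k} m≤k 1≤k e = <-irrefl e (begin-strict
      m * m           ≤⟨ *-monoʳ-≤ m m≤k ⟩
      m * k           <⟨ m<m+n (m * k) (*-mono-≤ 1≤k 1≤k) ⟩
      m * k + k * k   ∎)
      where open ≤-Reasoning

    expand : ∀ k r → (k + r) * (k + r) ≡ (k * r + r * r) + (k * k + k * r)
    expand = solve-∀

    regroup : ∀ k r → (k + r) * k + k * k ≡ k * k + (k * k + k * r)
    regroup = solve-∀

    shift : ∀ k r → (k + r) * (k + r) ≡ (k + r) * k + k * k → k * k ≡ k * r + r * r
    shift k r e = sym (+-cancelʳ-≡ (k * k + k * r) _ _
      (trans (sym (expand k r)) (trans e (regroup k r))))

    positive-offset : ∀ {k r} → k < k + r → 1 ≤ r
    positive-offset {k} {r} k<k+r = +-cancelˡ-≤ k 1 r (subst (_≤ k + r) (+-comm 1 k) k<k+r)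

    descent : ∀ k → (∀ {r} → r < k → ∀ m → 1 ≤ r → ¬ (m * m ≡ m * r + r * r)) →
              ∀ m → 1 ≤ k → ¬ (m * m ≡ m * k + k * k)
    descent k smaller m 1≤k e with k <? m
    ... | no k≮m = too-small (≮⇒≥ k≮m) 1≤k e
    ... | yes k<m with m≤n⇒∃[o]m+o≡n (<⇒≤ k<m)
    ...   | r , refl with k ≤? r
    ...     | yes k≤r = too-small k≤r (positive-offset k<m) (shift k r e)
    ...     | no k≰r = smaller (≰⇒> k≰r) k (positive-offset k<m) (shift k r e)

module GoldenFloor where

  open import Data.Nat as ℕ using (ℕ; zero; suc)
  import Data.Nat.Properties as ℕ
  open import Data.Integer hiding (suc)
  open import Data.Integer.Properties using (pos-*; +-injective; +-identityʳ; ⊖-≥; m-n≡m⊖n)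
  open import Relation.Binary.Definitions using (tri<; tri≈; tri>)
  open import Data.Integer.Tactic.RingSolver using (solve-∀)
  open import Data.Product using (Σ; _×_; _,_)
  open import Data.Sum using (_⊎_; inj₁; inj₂)
  open import Data.Empty using (⊥; ⊥-elim)
  open import Relation.Nullary using (¬_)
  open import Relation.Binary.PropositionalEquality

  -- Sign arguments are done with explicit non-negativity certificates: IsNat x witnesses
  -- x ≥ 0, sums and products preserve it, and an identity a + 1 = 0 with a ≥ 0 refutes.
  IsNat : ℤ → Set
  IsNat x = Σ ℕ λ n → x ≡ + n

  isNat : ∀ n → IsNat (+ n)
  isNat n = n , refl

  nat-+ : ∀ {a b} → IsNat a → IsNat b → IsNat (a + b)
  nat-+ (m , refl) (n , refl) = m ℕ.+ n , refl

  nat-* : ∀ {a b} → IsNat a → IsNat b → IsNat (a * b)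
  nat-* (m , refl) (n , refl) = m ℕ.* n , sym (pos-* m n)

  nat-≡ : ∀ {a b} → a ≡ b → IsNat a → IsNat b
  nat-≡ refl a≥0 = a≥0

  nat-absurd : ∀ {a} → IsNat a → ¬ (a + 1ℤ ≡ 0ℤ)
  nat-absurd (n , refl) e = ℕ.1+n≢0 (trans (ℕ.+-comm 1 n) (+-injective e))

  nat-or-neg : ∀ x → IsNat x ⊎ IsNat (- x - 1ℤ)
  nat-or-neg (+ n) = inj₁ (n , refl)
  nat-or-neg -[1+ n ] = inj₂ (n , cancel (+ n))
    where
    cancel : ∀ x → 1ℤ + x - 1ℤ ≡ x
    cancel = solve-∀

  nat-by-contradiction : ∀ x → (IsNat (- x - 1ℤ) → ⊥) → IsNat x
  nat-by-contradiction x negative with nat-or-neg x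
  ... | inj₁ x≥0 = x≥0
  ... | inj₂ x≤-1 = ⊥-elim (negative x≤-1)

  nat-nonzero : ∀ {a} → IsNat a → ¬ (a ≡ 0ℤ) → IsNat (a - 1ℤ)
  nat-nonzero (zero , refl) a≢0 = ⊥-elim (a≢0 refl)
  nat-nonzero (suc n , refl) _ = n , refl

  nat-quarter : ∀ x → IsNat (+ 4 * x + + 3) → IsNat x
  nat-quarter x 4x+3≥0 = nat-by-contradiction x λ x≤-1 →
    nat-absurd (nat-+ 4x+3≥0 (nat-* (isNat 4) x≤-1)) (certificate x)
    where
    certificate : ∀ x → (+ 4 * x + + 3) + + 4 * (- x - 1ℤ) + 1ℤ ≡ 0ℤ
    certificate = solve-∀

  -- The norm form of ℤ[φ] up to sign:  Q(k, n) = k² − kn − n² = (k − nφ)(k + nψ).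
  Q : ℤ → ℤ → ℤ
  Q k n = k * k - k * n - n * n

  -- For natural n and k,  k = ⌊nφ⌋  ⇔  Q(k, n) ≤ 0 < Q(k + 1, n),
  -- since for k ≥ 0 the sign of Q(k, n) is the sign of k − nφ.
  IsFloor : ℤ → ℤ → Set
  IsFloor n k = IsNat (- Q k n) × IsNat (Q (k + 1ℤ) n - 1ℤ)

  -- k ≤ nφ implies k ≤ 2n (as φ < 2).
  below-double : ∀ n k → IsNat n → IsNat k → IsNat (- Q k n) → IsNat (+ 2 * n - k)
  below-double n k n≥0 k≥0 lower = nat-by-contradiction (+ 2 * n - k) λ k>2n →
    nat-absurd (nat-+ (nat-+ (nat-+ (nat-+ lower (nat-* k>2n (nat-+ k≥0 n≥0))) k>2n)
                             (nat-* n≥0 n≥0)) (nat-* (isNat 3) n≥0))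
               (certificate n k)
    where
    certificate : ∀ n k → (- (k * k - k * n - n * n) + (- (+ 2 * n - k) - 1ℤ) * (k + n)
                            + (- (+ 2 * n - k) - 1ℤ) + n * n) + + 3 * n + 1ℤ ≡ 0ℤ
    certificate = solve-∀

  -- Q(·, n) stays positive once positive: Q(k + 1, n) > 0 implies Q(k + 1 + d, n) > 0.
  -- (If k + 1 ≤ n then Q(k + 1, n) ≤ 0 anyway; otherwise Q(·, n) increases from k + 1 on.)
  Q-stays-positive : ∀ n k d → IsNat n → IsNat k → IsNat d →
                     IsNat (Q (k + 1ℤ) n - 1ℤ) → ¬ IsNat (- Q (k + 1ℤ + d) n)
  Q-stays-positive n k d n≥0 k≥0 d≥0 upper lower′ with nat-or-neg ((k + 1ℤ) - n)
  ... | inj₂ k+1<n = nat-absurd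
          (nat-+ (nat-+ upper (nat-* (nat-+ k≥0 (isNat 1)) (nat-+ k+1<n (isNat 1)))) (nat-* n≥0 n≥0))
          (small-k n k)
    where
    small-k : ∀ n k → ((k + 1ℤ) * (k + 1ℤ) - (k + 1ℤ) * n - n * n - 1ℤ
                        + (k + 1ℤ) * ((- ((k + 1ℤ) - n) - 1ℤ) + 1ℤ)) + n * n + 1ℤ ≡ 0ℤ
    small-k = solve-∀
  ... | inj₁ k+1≥n = nat-absurd
          (nat-+ (nat-+ lower′ upper) (nat-* d≥0 (nat-+ (nat-+ d≥0 (nat-+ k≥0 (isNat 1))) k+1≥n)))
          (large-k n k d)
    where
    large-k : ∀ n k d → (- ((k + 1ℤ + d) * (k + 1ℤ + d) - (k + 1ℤ + d) * n - n * n)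
                          + ((k + 1ℤ) * (k + 1ℤ) - (k + 1ℤ) * n - n * n - 1ℤ)
                          + d * (d + (k + 1ℤ) + ((k + 1ℤ) - n))) + 1ℤ ≡ 0ℤ
    large-k = solve-∀

  -- Two Beatty-type recurrences, both coming from Q(a + b, a) = −Q(a, b) (multiplication
  -- by φ is a norm −1 map) applied to the bounds defining k = ⌊nφ⌋:
  -- ⌊(⌊nφ⌋ + 1)φ⌋ = ⌊nφ⌋ + 1 + n,
  floor-after-floor : ∀ n k → IsNat n → IsNat k → IsFloor n k → IsFloor (k + 1ℤ) (k + 1ℤ + n)
  floor-after-floor n k n≥0 k≥0 (lower , upper) =
      nat-≡ (new-lower n k) (nat-+ upper (isNat 1))
    , nat-≡ (new-upper n k) (nat-+ (nat-+ lower (below-double n k n≥0 k≥0 lower)) n≥0)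
    where
    new-lower : ∀ n k → ((k + 1ℤ) * (k + 1ℤ) - (k + 1ℤ) * n - n * n - 1ℤ) + 1ℤ
      ≡ - ((k + 1ℤ + n) * (k + 1ℤ + n) - (k + 1ℤ + n) * (k + 1ℤ) - (k + 1ℤ) * (k + 1ℤ))
    new-lower = solve-∀
    new-upper : ∀ n k → - (k * k - k * n - n * n) + (+ 2 * n - k) + n
      ≡ (k + 1ℤ + n + 1ℤ) * (k + 1ℤ + n + 1ℤ) - (k + 1ℤ + n + 1ℤ) * (k + 1ℤ)
        - (k + 1ℤ) * (k + 1ℤ) - 1ℤ
    new-upper = solve-∀

  -- and ⌊⌊nφ⌋φ⌋ = ⌊nφ⌋ + n − 1 for n ≥ 1, given that ⌊nφ⌋ < nφ strictly.
  floor-of-floor : ∀ n k → IsNat (n - 1ℤ) → IsNat k → IsFloor n k → IsNat (- Q k n - 1ℤ) →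
                   IsFloor k (k + (n - 1ℤ))
  floor-of-floor n k n-1≥0 k≥0 (lower , upper) strict =
      nat-≡ (new-lower n k) (nat-+ (nat-+ upper (below-double n k n≥0 k≥0 lower)) n-1≥0)
    , nat-≡ (new-upper n k) strict
    where
    add-back : ∀ n → n - 1ℤ + 1ℤ ≡ n
    add-back = solve-∀
    n≥0 : IsNat n
    n≥0 = nat-≡ (add-back n) (nat-+ n-1≥0 (isNat 1))
    new-lower : ∀ n k → ((k + 1ℤ) * (k + 1ℤ) - (k + 1ℤ) * n - n * n - 1ℤ) + (+ 2 * n - k) + (n - 1ℤ)
      ≡ - ((k + (n - 1ℤ)) * (k + (n - 1ℤ)) - (k + (n - 1ℤ)) * k - k * k)
    new-lower = solve-∀
    new-upper : ∀ n k → - (k * k - k * n - n * n) - 1ℤ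
      ≡ (k + (n - 1ℤ) + 1ℤ) * (k + (n - 1ℤ) + 1ℤ) - (k + (n - 1ℤ) + 1ℤ) * k - k * k - 1ℤ
    new-upper = solve-∀

  -- For natural n ≥ 1 and m,  Q(m, n) ≠ 0 because φ is irrational; so a lower bound
  -- m ≤ nφ is always strict.
  floor-strict : ∀ n m → IsNat (- Q (+ m) (+ suc n)) → IsNat (- Q (+ m) (+ suc n) - 1ℤ)
  floor-strict n m lower = nat-nonzero lower λ Q≡0 →
    Irrationality.no-golden-ratio (suc n) m (ℕ.s≤s ℕ.z≤n) (+-injective (golden-equation Q≡0))
    where
    M K : ℤ
    M = + m
    K = + suc n
    rearrange : ∀ m k → m * m ≡ m * k + k * k - (- (m * m - m * k - k * k))
    rearrange = solve-∀
    golden-equation : - Q M K ≡ 0ℤ → + (m ℕ.* m) ≡ + (m ℕ.* suc n ℕ.+ suc n ℕ.* suc n)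
    golden-equation Q≡0 = begin
      + (m ℕ.* m)                ≡⟨ pos-* m m ⟩
      M * M                      ≡⟨ rearrange M K ⟩
      M * K + K * K - (- Q M K)  ≡⟨ cong (λ x → M * K + K * K - x) Q≡0 ⟩
      M * K + K * K - 0ℤ         ≡⟨ +-identityʳ (M * K + K * K) ⟩
      M * K + K * K              ≡⟨ cong₂ _+_ (pos-* m (suc n)) (pos-* (suc n) (suc n)) ⟨
      + (m ℕ.* suc n ℕ.+ suc n ℕ.* suc n) ∎
      where open ≡-Reasoning

  -- There is at most one floor: a value above a floor k already has Q(·, n) > 0.
  above-floor : ∀ n k k′ → k ℕ.< k′ → IsFloor (+ n) (+ k) → ¬ IsFloor (+ n) (+ k′)
  above-floor n k k′ k<k′ (_ , upper) (lower′ , _) with ℕ.m≤n⇒∃[o]m+o≡n k<k′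
  ... | d , refl = Q-stays-positive (+ n) (+ k) (+ d) (isNat n) (isNat k) (isNat d) upper
    (subst (λ k′ → IsNat (- Q k′ (+ n))) (cong (λ j → + (j ℕ.+ d)) (ℕ.+-comm 1 k)) lower′)

  floor-unique : ∀ n k k′ → IsFloor (+ n) (+ k) → IsFloor (+ n) (+ k′) → k ≡ k′
  floor-unique n k k′ f f′ with ℕ.<-cmp k k′
  ... | tri< k<k′ _ _ = ⊥-elim (above-floor n k k′ k<k′ f f′)
  ... | tri≈ _ k≡k′ _ = k≡k′
  ... | tri> _ _ k′<k = ⊥-elim (above-floor n k′ k k′<k f′ f)

  pos-∸ : ∀ {a b} → a ℕ.≤ b → + (b ℕ.∸ a) ≡ + b - + a
  pos-∸ {a} {b} a≤b = sym (trans (m-n≡m⊖n b a) (⊖-≥ a≤b))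

  nat-diff : ∀ {a b} → a ℕ.≤ b → IsNat (+ b - + a)
  nat-diff {a} {b} a≤b = b ℕ.∸ a , sym (pos-∸ a≤b)

  pos-square : ∀ a → + (a ℕ.^ 2) ≡ + a * + a
  pos-square a = trans (pos-* a (a ℕ.* 1)) (cong (λ b → + a * + b) (ℕ.*-identityʳ a))

  -- The lower half of IsFloorNφ:  2k ≤ n, or (2k − n)² ≤ 5n², where 5n² − (2k − n)² = −4Q(k, n).
  spec-lower : ∀ n k → 2 ℕ.* k ℕ.≤ n ⊎ (2 ℕ.* k ℕ.∸ n) ℕ.^ 2 ℕ.≤ 5 ℕ.* n ℕ.^ 2 →
               IsNat (- Q (+ k) (+ n))
  spec-lower n k (inj₁ 2k≤n) = small-k n k 2k≤n
    where
    small-k : ∀ n k → 2 ℕ.* k ℕ.≤ n → IsNat (- Q (+ k) (+ n))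
    small-k n k 2k≤n = nat-≡ (certificate (+ n) (+ k))
      (nat-+ (nat-+ (nat-* (isNat k) (nat-≡ (cong (λ x → + n - x) (pos-* 2 k)) (nat-diff 2k≤n)))
                    (nat-* (isNat k) (isNat k))) (nat-* (isNat n) (isNat n)))
      where
      certificate : ∀ n k → k * (n - + 2 * k) + k * k + n * n ≡ - (k * k - k * n - n * n)
      certificate = solve-∀
  spec-lower n k (inj₂ square≤) with ℕ.≤-total (2 ℕ.* k) n
  ... | inj₁ 2k≤n = spec-lower n k (inj₁ 2k≤n)
  ... | inj₂ n≤2k = nat-quarter (- Q (+ k) (+ n)) (nat-≡ (certificate (+ n) (+ k))
          (nat-+ (nat-≡ (cong₂ _-_ five-n² [2k-n]²) (nat-diff square≤)) (isNat 3)))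
    where
    five-n² : + (5 ℕ.* n ℕ.^ 2) ≡ + 5 * (+ n * + n)
    five-n² = trans (pos-* 5 (n ℕ.^ 2)) (cong (+ 5 *_) (pos-square n))
    2k-n : + (2 ℕ.* k ℕ.∸ n) ≡ + 2 * + k - + n
    2k-n = trans (pos-∸ n≤2k) (cong (_- + n) (pos-* 2 k))
    [2k-n]² : + ((2 ℕ.* k ℕ.∸ n) ℕ.^ 2) ≡ (+ 2 * + k - + n) * (+ 2 * + k - + n)
    [2k-n]² = trans (pos-square (2 ℕ.* k ℕ.∸ n)) (cong₂ _*_ 2k-n 2k-n)
    certificate : ∀ n k → + 5 * (n * n) - (+ 2 * k - n) * (+ 2 * k - n) + + 3
                         ≡ + 4 * - (k * k - k * n - n * n) + + 3
    certificate = solve-∀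

  -- The upper half:  5n² < (2(k + 1) − n)², where (2(k + 1) − n)² − 5n² = 4Q(k + 1, n).
  spec-upper : ∀ n k → n ℕ.< 2 ℕ.* suc k → 5 ℕ.* n ℕ.^ 2 ℕ.< (2 ℕ.* suc k ℕ.∸ n) ℕ.^ 2 →
               IsNat (Q (+ k + 1ℤ) (+ n) - 1ℤ)
  spec-upper n k n<2k+2 square> = nat-quarter (Q (+ k + 1ℤ) (+ n) - 1ℤ)
    (nat-≡ (certificate (+ n) (+ k))
      (nat-≡ (cong₂ _-_ [2k+2-n]² (cong (λ x → 1ℤ + x) five-n²)) (nat-diff square>)))
    where
    five-n² : + (5 ℕ.* n ℕ.^ 2) ≡ + 5 * (+ n * + n)
    five-n² = trans (pos-* 5 (n ℕ.^ 2)) (cong (+ 5 *_) (pos-square n))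
    2k+2-n : + (2 ℕ.* suc k ℕ.∸ n) ≡ + 2 * (+ k + 1ℤ) - + n
    2k+2-n = trans (pos-∸ (ℕ.<⇒≤ n<2k+2)) (cong (_- + n)
               (trans (pos-* 2 (suc k)) (cong (λ j → + 2 * + j) (ℕ.+-comm 1 k))))
    [2k+2-n]² : + ((2 ℕ.* suc k ℕ.∸ n) ℕ.^ 2)
              ≡ (+ 2 * (+ k + 1ℤ) - + n) * (+ 2 * (+ k + 1ℤ) - + n)
    [2k+2-n]² = trans (pos-square (2 ℕ.* suc k ℕ.∸ n)) (cong₂ _*_ 2k+2-n 2k+2-n)
    certificate : ∀ n k → (+ 2 * (k + 1ℤ) - n) * (+ 2 * (k + 1ℤ) - n) - (1ℤ + + 5 * (n * n))
      ≡ + 4 * ((k + 1ℤ) * (k + 1ℤ) - (k + 1ℤ) * n - n * n - 1ℤ) + + 3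
    certificate = solve-∀

  floor-from-spec : ∀ n k → IsFloorNφ n k → IsFloor (+ n) (+ k)
  floor-from-spec n k (lower , n<2k+2 , square>) =
    spec-lower n k lower , spec-upper n k n<2k+2 square>

  floor-after-floorℕ : ∀ n k → IsFloor (+ n) (+ k) → IsFloor (+ suc k) (+ (suc k ℕ.+ n))
  floor-after-floorℕ n k floor = subst (λ j → IsFloor (+ j) (+ (j ℕ.+ n))) (ℕ.+-comm k 1)
    (floor-after-floor (+ n) (+ k) (isNat n) (isNat k) floor)

  floor-of-floorℕ : ∀ i k → IsFloor (+ suc i) (+ k) → IsFloor (+ k) (+ (k ℕ.+ i))
  floor-of-floorℕ i k floor@(lower , _) =
    floor-of-floor (+ suc i) (+ k) (isNat i) (isNat k) floor (floor-strict i k lower)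

module FibonacciFloors where

  open import Data.Nat
  open import Data.Nat.Properties
  open import Data.Nat.Induction using (<-rec)
  open import Data.Product using (_,_)
  open import Data.Sum using (inj₁; inj₂)
  open import Data.Empty using (⊥-elim)
  open import Relation.Binary.PropositionalEquality
  open FibonacciWord using (countA; desubstitute)
  open GoldenFloor using (IsFloor; floor-after-floorℕ; floor-of-floorℕ; floor-unique; floor-from-spec)

  -- If the first m + 1 letters of c are exactly σ(c₁ … cᵢ), then i ≤ m: for i = m + 1 the
  -- lengths force c₁ … c_{m+1} to contain no A, while it contains i of them.
  block-shorter : ∀ m i → suc m ≡ i + countA i → countA (suc m) ≡ i → i < suc m
  block-shorter m i e e′ with m≤n⇒m<n∨m≡n (subst (i ≤_) (sym e) (m≤m+n i (countA i)))
  ... | inj₁ i<m+1 = i<m+1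
  ... | inj₂ refl = ⊥-elim (1+n≢0 (trans (sym e′) no-A))
    where
    no-A : countA (suc m) ≡ 0
    no-A = +-cancelˡ-≡ (suc m) (countA (suc m)) 0 (trans (sym e) (sym (+-identityʳ (suc m))))

  -- ⌊(m + 1)φ⌋ = (m + 1) + #A(c₁ … c_m), by strong induction: desubstituting the first
  -- m + 1 letters reduces to a shorter prefix, and the two Beatty recurrences lift the
  -- formula back (σ(c₁ … cᵢ) for floor-of-floor, one more letter A for floor-after-floor).
  floor-formula : ∀ m → IsFloor (+ suc m) (+ (suc m + countA m))
  floor-formula = <-rec (λ m → IsFloor (+ suc m) (+ (suc m + countA m))) step
    where
    step : ∀ m → (∀ {i} → i < m → IsFloor (+ suc i) (+ (suc i + countA i))) →
           IsFloor (+ suc m) (+ (suc m + countA m))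
    step zero _ = (1 , refl) , (0 , refl)   -- ⌊φ⌋ = 1: Q(1, 1) = −1 and Q(2, 1) = 1
    step (suc m) smaller with desubstitute (suc m)
    ... | i , inj₁ (e , e′) =
      subst₂ (λ a b → IsFloor (+ a) (+ (a + b))) (sym (cong suc e)) (sym e′)
        (floor-of-floorℕ i (suc i + countA i) (smaller (block-shorter m i e e′)))
    ... | i , inj₂ (e , e′) =
      subst₂ (λ a b → IsFloor (+ suc a) (+ (suc a + b))) (sym e) (sym e′)
        (floor-after-floorℕ (suc i) (suc i + countA i) (smaller i<m+1))
      where
      i<m+1 : i < suc m
      i<m+1 = subst (i <_) (sym e) (s≤s (m≤m+n i (countA i)))

  floor-spec-formula : ∀ m k → IsFloorNφ (suc m) k → k ≡ suc m + countA m
  floor-spec-formula m k spec =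
    floor-unique (suc m) k (suc m + countA m) (floor-from-spec (suc m) k spec) (floor-formula m)

module Increment where

  open import Data.Nat as ℕ using (ℕ; suc)
  import Data.Nat.Tactic.RingSolver as ℕ-Solver
  open import Data.Integer hiding (suc)
  open import Data.Integer.Properties using (+-assoc)
  open import Data.Integer.Tactic.RingSolver using (solve-∀)
  open import Data.Product using (_,_)
  open import Relation.Binary.PropositionalEquality
  open FibonacciWord using (isA; countA)

  letter-value : ∀ (P : ℤφ) x → P +φ v x ≡ P +φ oneMinusψ *φ ι (+ isA x) +φ ψ
  letter-value (a , b) A = cong₂ _,_ (sym (+-assoc a _ _)) (sym (+-assoc b _ _))
  letter-value (a , b) B = cong₂ _,_ (sym (+-assoc a _ _)) (sym (+-assoc b _ _))

  floor-difference : ∀ m → + (suc (suc m) ℕ.+ countA (suc m)) - + (suc m ℕ.+ countA m) - + 1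
                           ≡ + isA (c (suc m))
  floor-difference m = begin
    + (suc (suc m) ℕ.+ (a ℕ.+ e)) - + x - + 1  ≡⟨ cong (λ y → + y - + x - + 1) (regroup m a e) ⟩
    + x + (1ℤ + + e) - + x - 1ℤ               ≡⟨ cancel (+ x) (+ e) ⟩
    + e                                       ∎
    where
    open ≡-Reasoning
    a e x : ℕ
    a = countA m
    e = isA (c (suc m))
    x = suc m ℕ.+ a
    regroup : ∀ m a e → suc (suc m) ℕ.+ (a ℕ.+ e) ≡ (suc m ℕ.+ a) ℕ.+ suc e
    regroup = ℕ-Solver.solve-∀
    cancel : ∀ x e → x + (1ℤ + e) - x - 1ℤ ≡ e
    cancel = solve-∀

  increment : ∀ m → p (suc m) ≡ p m +φ oneMinusψ *φ
                 ι (+ (suc (suc m) ℕ.+ countA (suc m)) - + (suc m ℕ.+ countA m) - + 1) +φ ψ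
  increment m = begin
    p m +φ v (c (suc m))                             ≡⟨ letter-value (p m) (c (suc m)) ⟩
    p m +φ oneMinusψ *φ ι (+ isA (c (suc m))) +φ ψ   ≡⟨ cong (λ d → p m +φ oneMinusψ *φ ι d +φ ψ)
                                                             (floor-difference m) ⟨
    p m +φ oneMinusψ *φ
      ι (+ (suc (suc m) ℕ.+ countA (suc m)) - + (suc m ℕ.+ countA m) - + 1) +φ ψ ∎
    where open ≡-Reasoning

open FibonacciFloors using (floor-spec-formula)
open Increment using (increment)

mainTheorem10 : (n : ℕ) → 1 < n → (k k′ : ℕ) → IsFloorNφ n k → IsFloorNφ (suc n) k′ →
    p n ≡ p (n ∸ 1) +φ oneMinusψ *φ ι ((+ k′) - (+ k) - (+ 1)) +φ ψ
mainTheorem10 (suc m) _ k k′ ⌊nφ⌋ ⌊[n+1]φ⌋ =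
  subst₂ (λ a b → p (suc m) ≡ p m +φ oneMinusψ *φ ι (+ b - + a - + 1) +φ ψ)
         (sym (floor-spec-formula m k ⌊nφ⌋)) (sym (floor-spec-formula (suc m) k′ ⌊[n+1]φ⌋))
         (increment m)
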